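{- Let $n \ge 1$. For $1 \le k \le n$ let $G_{n,k}$ be the graph with vertex set $\{0,1\}^n$ in which $u,v$ are adjacent iff $\|u-v\| = k$, where $\|w\| = \sum_i |w_i|$ (Hamming distance). If $\chi(G_{n,k}) \le n+1$ for every $k$, then every subset $A \subseteq \{0,1\}^n$ with at least two points can be partitioned into at most $n+1$ parts, each of diameter strictly smaller than $\operatorname{diam} A$.
   Context: Diameters are taken with respect to the Euclidean metric, equivalently the Hamming metric on $\{0,1\}^n$. $\chi$ denotes chromatic number. -}

module Defs where

open import Data.Bool using (Bool; true; false; _∧_; if_then_else_)
open import Data.Nat using (ℕ; zero; suc; _+_; _⊔_)
open import Data.Fin using (Fin; _≟_)
open import Data.Vec using (Vec; []; _∷_)
open import Data.List using (List; []; _∷_; map; _++_; concatMap; foldr)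
open import Relation.Binary.PropositionalEquality using (_≡_)
open import Relation.Nullary using (¬_)
open import Data.Product using (Σ)
open import Relation.Nullary.Decidable using (⌊_⌋)

-- The cube {0,1}^n; true = 1, false = 0.
Cube : ℕ → Set
Cube n = Vec Bool n

absDiff : Bool → Bool → ℕ
absDiff true  true  = 0
absDiff false false = 0
absDiff true  false = 1
absDiff false true  = 1

dist : ∀ {n} → Cube n → Cube n → ℕ
dist []       []       = 0
dist (a ∷ u) (b ∷ v) = absDiff a b + dist u v

Subset : ℕ → Set
Subset n = Cube n → Bool

allPoints : (n : ℕ) → List (Cube n)
allPoints zero    = [] ∷ []
allPoints (suc n) = map (true ∷_) (allPoints n) ++ map (false ∷_) (allPoints n)

maxList : List ℕ → ℕ
maxList = foldr _⊔_ 0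

-- diam A = max { ‖u - v‖ : u, v ∈ A }  (0 for the empty set)
diam : ∀ {n} → Subset n → ℕ
diam {n} A =
  maxList (concatMap (λ u → map (λ v → if A u ∧ A v then dist u v else 0) (allPoints n)) (allPoints n))

ProperColouring : (n k m : ℕ) → (Cube n → Fin m) → Set
ProperColouring n k m c = ∀ (u v : Cube n) → dist u v ≡ k → ¬ (c u ≡ c v)

ChromaticAtMost : (n k m : ℕ) → Set
ChromaticAtMost n k m = Σ (Cube n → Fin m) (ProperColouring n k m)

part : ∀ {n m} → Subset n → (Cube n → Fin m) → Fin m → Subset n
part A f i u = A u ∧ ⌊ f u ≟ i ⌋

-- If d = diam A ≥ 1 then 1 ≤ d ≤ n, so a proper (n+1)-colouring c of G_{n,d} is available.
-- Two points of A at distance d are adjacent in G_{n,d} and hence get different colours,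
-- so within each colour class all distances are at most d but never equal to d.
module Submission where

open import Defs
open import Data.Nat using (ℕ; zero; suc; _≤_; _<_; z≤n)
open import Data.Nat.Properties
  using (⊔-lub; m⊔n≤o⇒m≤o; m⊔n≤o⇒n≤o; ≤-refl; ≤-trans; <-≤-trans; ≤∧≢⇒<; +-mono-≤; n≢0⇒n>0)
open import Data.Fin using (Fin; _≟_)
open import Data.Bool using (true; false; _∧_; if_then_else_)
open import Data.Vec using ([]; _∷_)
open import Data.List using (List; []; _∷_; map; _++_; concatMap; cartesianProductWith)
open import Data.List.Properties using (foldr-preservesᵇ; foldr-forcesᵇ)
open import Data.List.Relation.Unary.All as All using (All)
open import Data.List.Relation.Unary.All.Properties using (cartesianProductWith⁺)
open import Data.List.Relation.Unary.Any using (here)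
open import Data.List.Membership.Propositional using (_∈_)
open import Data.List.Membership.Propositional.Properties
  using (∈-map⁺; ∈-++⁺ˡ; ∈-++⁺ʳ; ∈-cartesianProductWith⁺)
open import Data.Product using (Σ; _×_; _,_)
open import Relation.Binary.PropositionalEquality using (_≡_; _≢_; refl; sym; trans; cong; setoid)
open import Relation.Nullary using (¬_; yes; no)

maxList-≤ : ∀ {b} {xs : List ℕ} → All (_≤ b) xs → maxList xs ≤ b
maxList-≤ = foldr-preservesᵇ ⊔-lub z≤n

-- suc m ⊔ suc n reduces to suc (m ⊔ n), so ⊔-lub also preserves _< b.
maxList-< : ∀ {b} {xs : List ℕ} → 0 < b → All (_< b) xs → maxList xs < b
maxList-< = foldr-preservesᵇ ⊔-lub

≤-maxList : ∀ {x} {xs : List ℕ} → x ∈ xs → x ≤ maxList xs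
≤-maxList {xs = xs} = All.lookup
  (foldr-forcesᵇ (λ m n m⊔n≤o → m⊔n≤o⇒m≤o m n m⊔n≤o , m⊔n≤o⇒n≤o m n m⊔n≤o) 0 xs ≤-refl)

concatMap-map≡cartesianProductWith : ∀ {X Y Z : Set} (g : X → Y → Z) xs ys →
  concatMap (λ x → map (g x) ys) xs ≡ cartesianProductWith g xs ys
concatMap-map≡cartesianProductWith g []       ys = refl
concatMap-map≡cartesianProductWith g (x ∷ xs) ys =
  cong (map (g x) ys ++_) (concatMap-map≡cartesianProductWith g xs ys)

allPoints-complete : ∀ n (u : Cube n) → u ∈ allPoints n
allPoints-complete zero []          = here refl
allPoints-complete (suc n) (true ∷ u)  = ∈-++⁺ˡ (∈-map⁺ (true ∷_) (allPoints-complete n u))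
allPoints-complete (suc n) (false ∷ u) =
  ∈-++⁺ʳ (map (true ∷_) (allPoints n)) (∈-map⁺ (false ∷_) (allPoints-complete n u))

absDiff≤1 : ∀ a b → absDiff a b ≤ 1
absDiff≤1 true  true  = z≤n
absDiff≤1 true  false = ≤-refl
absDiff≤1 false true  = ≤-refl
absDiff≤1 false false = z≤n

dist≤n : ∀ {n} (u v : Cube n) → dist u v ≤ n
dist≤n []      []      = z≤n
dist≤n (a ∷ u) (b ∷ v) = +-mono-≤ (absDiff≤1 a b) (dist≤n u v)

dist≡0⇒≡ : ∀ {n} (u v : Cube n) → dist u v ≡ 0 → u ≡ v
dist≡0⇒≡ []          []          _  = refl
dist≡0⇒≡ (true ∷ u)  (true ∷ v)  eq = cong (true ∷_) (dist≡0⇒≡ u v eq)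
dist≡0⇒≡ (false ∷ u) (false ∷ v) eq = cong (false ∷_) (dist≡0⇒≡ u v eq)

distIn : ∀ {n} → Subset n → Cube n → Cube n → ℕ
distIn A u v = if A u ∧ A v then dist u v else 0

diam≡maxList : ∀ {n} (A : Subset n) →
  diam A ≡ maxList (cartesianProductWith (distIn A) (allPoints n) (allPoints n))
diam≡maxList {n} A = cong maxList (concatMap-map≡cartesianProductWith (distIn A) (allPoints n) (allPoints n))

module _ {n} (A : Subset n) where

  dist≤diam : ∀ {u v} → A u ≡ true → A v ≡ true → dist u v ≤ diam A
  dist≤diam {u} {v} Au Av rewrite diam≡maxList A = ≤-trans dist≤distIn
    (≤-maxList (∈-cartesianProductWith⁺ (distIn A) (allPoints-complete n u) (allPoints-complete n v)))
    where
    dist≤distIn : dist u v ≤ distIn A u v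
    dist≤distIn rewrite Au | Av = ≤-refl

  distIn-bound : (P : ℕ → Set) → P 0 →
    (∀ {u v} → A u ≡ true → A v ≡ true → P (dist u v)) →
    All P (cartesianProductWith (distIn A) (allPoints n) (allPoints n))
  distIn-bound P P0 Pdist = cartesianProductWith⁺ (setoid (Cube n)) (setoid (Cube n))
    (distIn A) (allPoints n) (allPoints n) (λ {u} {v} _ _ → bound u v)
    where
    bound : ∀ u v → P (distIn A u v)
    bound u v with A u in Au | A v in Av
    ... | true  | true  = Pdist Au Av
    ... | true  | false = P0
    ... | false | _     = P0

  diam-≤ : ∀ {b} → (∀ {u v} → A u ≡ true → A v ≡ true → dist u v ≤ b) → diam A ≤ b
  diam-≤ {b} h rewrite diam≡maxList A = maxList-≤ (distIn-bound (_≤ b) z≤n h)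

  diam-< : ∀ {b} → 0 < b → (∀ {u v} → A u ≡ true → A v ≡ true → dist u v < b) → diam A < b
  diam-< {b} 0<b h rewrite diam≡maxList A = maxList-< 0<b (distIn-bound (_< b) 0<b h)

  diam>0 : ∀ {u v} → u ≢ v → A u ≡ true → A v ≡ true → 0 < diam A
  diam>0 {u} {v} u≢v Au Av =
    <-≤-trans (n≢0⇒n>0 (λ eq → u≢v (dist≡0⇒≡ u v eq))) (dist≤diam Au Av)

diam≤n : ∀ {n} (A : Subset n) → diam A ≤ n
diam≤n A = diam-≤ A λ {u} {v} _ _ → dist≤n u v

part⇒ : ∀ {n m} (A : Subset n) (f : Cube n → Fin m) i {u} →
  part A f i u ≡ true → A u ≡ true × f u ≡ i
part⇒ A f i {u} _   with A u | f u ≟ i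
part⇒ A f i     ()  | false | _
part⇒ A f i     _   | true  | yes fu≡i = refl , fu≡i
part⇒ A f i     ()  | true  | no _

diam-part< : ∀ {n m} (A : Subset n) (c : Cube n → Fin m) → 0 < diam A →
  ProperColouring n (diam A) m c → ∀ i → diam (part A c i) < diam A
diam-part< A c 0<d proper i = diam-< (part A c i) 0<d λ {u} {v} u∈Aᵢ v∈Aᵢ →
  let Au , cu≡i = part⇒ A c i u∈Aᵢ
      Av , cv≡i = part⇒ A c i v∈Aᵢ
  in ≤∧≢⇒< (dist≤diam A Au Av) (λ uv≡d → proper u v uv≡d (trans cu≡i (sym cv≡i)))

proposition1 : (n : ℕ) → 1 ≤ n →
    ((k : ℕ) → 1 ≤ k → k ≤ n → ChromaticAtMost n k (suc n)) →
    (A : Subset n) →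
    (Σ (Cube n) λ u → Σ (Cube n) λ v → ¬ (u ≡ v) × A u ≡ true × A v ≡ true) →
    Σ (Cube n → Fin (suc n)) λ f → (i : Fin (suc n)) → diam (part A f i) < diam A
proposition1 n _ χ≤n+1 A (u , v , u≢v , Au , Av)
  with 0<d ← diam>0 A u≢v Au Av
  with c , proper ← χ≤n+1 (diam A) 0<d (diam≤n A)
  = c , diam-part< A c 0<d proper
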